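{- Let $m\geq 2$ and $n\geq 2$ be integers, let $G_m$ be a connected graph of order $m$ and let $K_n$ be the complete graph of order $n$. Then $rvcl(G_m \diamond K_n)\geq n+1$.
   Context: All graphs are finite, simple, connected and undirected; $d(\cdot,\cdot)$ is the graph distance. For $k\in\mathbb{N}$, a rainbow vertex $k$-coloring of $G$ is a function $c: V(G)\to\{1,\dots,k\}$ such that every two vertices $u,v$ are joined by a $u$–$v$ path whose internal vertices have pairwise distinct colors. For such $c$ (using all $k$ colors), let $R_i$ be the set of vertices of color $i$ and $\Pi=(R_1,\dots,R_k)$; the rainbow code of $v$ is $rc_\Pi(v)=(d(v,R_1),\dots,d(v,R_k))$, where $d(v,R_i)=\min_{x\in R_i} d(v,x)$. The coloring $c$ is a locating rainbow $k$-coloring if it is a rainbow vertex $k$-coloring and all vertices have pairwise distinct rainbow codes. $rvcl(G)$ is the smallest positive integer $k$ such that $G$ has a locating rainbow $k$-coloring. The edge corona $G\diamond H$ is obtained from one copy of $G$ and $|E(G)|$ copies of $H$, where, enumerating the edges of $G$ as $e_1,\dots,e_{|E(G)|}$, both end vertices of $e_j$ are joined to every vertex of the $j$-th copy of $H$. -}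

module Defs where

open import Level using (0ℓ)
open import Data.Nat using (ℕ; zero; suc; _≤_)
open import Data.Fin using (Fin; _<_)
open import Data.Bool using (Bool; true; false)
open import Data.Product using (Σ; _×_; _,_; ∃; ∃-syntax; proj₁; proj₂)
open import Data.Sum using (_⊎_; inj₁; inj₂)
open import Data.List using (List; []; _∷_; _++_; map)
open import Data.List.Relation.Unary.Unique.Propositional using (Unique)
open import Function.Definitions using (Surjective)
open import Relation.Binary.PropositionalEquality using (_≡_; _≢_)
open import Relation.Nullary using (¬_)

record SimpleGraph (m : ℕ) : Set where
  field
    adj    : Fin m → Fin m → Bool
    sym    : ∀ i j → adj i j ≡ adj j i
    irrefl : ∀ i → adj i i ≡ false
open SimpleGraph public

record Graph : Set₁ where
  field
    V   : Set
    Adj : V → V → Set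
open Graph public

toGraph : ∀ {m} → SimpleGraph m → Graph
toGraph {m} G = record { V = Fin m ; Adj = λ i j → adj G i j ≡ true }

data Walk (G : Graph) : V G → V G → ℕ → Set where
  nil  : ∀ {u} → Walk G u u zero
  cons : ∀ {u w v k} → Adj G u w → Walk G w v k → Walk G u v (suc k)

Connected : Graph → Set
Connected G = ∀ u v → ∃[ k ] Walk G u v k

Complete : ℕ → Graph
Complete n = record { V = Fin n ; Adj = λ x y → x ≢ y }

-- Edges of a simple graph on Fin m: pairs i < j with i adjacent to j
-- (each edge listed exactly once).
Edge : ∀ {m} → SimpleGraph m → Set
Edge {m} G = Σ (Fin m × Fin m) λ p → (proj₁ p < proj₂ p) × (adj G (proj₁ p) (proj₂ p) ≡ true)

EndOf : ∀ {m} (G : SimpleGraph m) → Fin m → Edge G → Set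
EndOf G a ((i , j) , _) = (a ≡ i) ⊎ (a ≡ j)

-- Edge corona G ⋄ H: one copy of G, one copy of H for every edge e of G,
-- both ends of e joined to every vertex of the copy of H indexed by e.
CoronaAdj : ∀ {m} (G : SimpleGraph m) (H : Graph) →
            (Fin m ⊎ (Edge G × V H)) → (Fin m ⊎ (Edge G × V H)) → Set
CoronaAdj G H (inj₁ a)       (inj₁ b)       = adj G a b ≡ true
CoronaAdj G H (inj₁ a)       (inj₂ (e , x)) = EndOf G a e
CoronaAdj G H (inj₂ (e , x)) (inj₁ a)       = EndOf G a e
CoronaAdj G H (inj₂ (e , x)) (inj₂ (f , y)) = (e ≡ f) × Adj H x y

EdgeCorona : ∀ {m} → SimpleGraph m → Graph → Graph
EdgeCorona {m} G H = record { V = Fin m ⊎ (Edge G × V H) ; Adj = CoronaAdj G H }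

-- A u–v path given by its list of internal vertices ws: u, ws, v consecutive
-- adjacent, all vertices pairwise distinct.
data Chain (G : Graph) : V G → List (V G) → V G → Set where
  edge : ∀ {u v} → Adj G u v → Chain G u [] v
  step : ∀ {u w ws v} → Adj G u w → Chain G w ws v → Chain G u (w ∷ ws) v

IsPath : (G : Graph) → V G → List (V G) → V G → Set
IsPath G u ws v = Chain G u ws v × Unique (u ∷ ws ++ (v ∷ []))

IsRainbowColoring : (G : Graph) (k : ℕ) → (V G → Fin k) → Set
IsRainbowColoring G k c =
  ∀ u v → u ≢ v → ∃[ ws ] (IsPath G u ws v × Unique (map c ws))

-- d(v, R_i) = d, where R_i = c⁻¹(i): some vertex of color i is reached by a
-- walk of length d, and every walk from v to a vertex of color i has length ≥ d.
SetDist : (G : Graph) (k : ℕ) → (V G → Fin k) → V G → Fin k → ℕ → Set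
SetDist G k c v i d =
  (∃[ x ] (c x ≡ i × Walk G v x d)) ×
  (∀ x j → c x ≡ i → Walk G v x j → d ≤ j)

-- Rainbow codes of u and v coincide (componentwise equal distances).
SameCode : (G : Graph) (k : ℕ) → (V G → Fin k) → V G → V G → Set
SameCode G k c u v = ∀ i d → (SetDist G k c u i d → SetDist G k c v i d)
                            × (SetDist G k c v i d → SetDist G k c u i d)

IsLocatingRainbowColoring : (G : Graph) (k : ℕ) → (V G → Fin k) → Set
IsLocatingRainbowColoring G k c =
  Surjective _≡_ _≡_ c ×
  IsRainbowColoring G k c ×
  (∀ u v → u ≢ v → ¬ SameCode G k c u v)

{-# OPTIONS --safe #-}
-- Two vertices u, v have the same rainbow code as soon as every walk from u to a
-- vertex of colour i can be matched by a walk from v, no longer, to a vertex of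
-- colour i, and vice versa.  In G ⋄ Kₙ the n vertices of the copy of Kₙ over an
-- edge e are closed twins, so a locating colouring is injective on them and
-- k ≥ n.  If k ≤ n, those n vertices carry every colour, so an end vertex a of e
-- and the copy vertex of colour c(a) both see all colours within distance 1 and
-- again share their code.
module Submission where

open import Defs hiding (sym)
open import Data.Nat using (ℕ; suc; zero; _≤_; z≤n; s≤s)
open import Data.Nat.Properties using (≤-trans; ≤-antisym; ≤-refl; n≤1+n; 1+n≰n; ≰⇒>)
open import Data.Fin using (Fin; punchOut) renaming (zero to fzero; suc to fsuc)
open import Data.Fin.Properties using (any?; injective⇒≤; punchOut-injective; _≟_)
open import Data.Product using (_×_; _,_; proj₁; proj₂; ∃-syntax)
open import Data.Sum using (_⊎_; inj₁; inj₂)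
open import Data.Empty using (⊥; ⊥-elim)
open import Function using (_∘_)
open import Function.Definitions using (Injective; StrictlySurjective)
open import Relation.Binary.PropositionalEquality using (_≡_; _≢_; refl; sym; trans; subst)
open import Relation.Nullary using (¬_; yes; no; contradiction)

injective⇒strictlySurjective : ∀ {n k} {g : Fin n → Fin k} → k ≤ n →
                               Injective _≡_ _≡_ g → StrictlySurjective _≡_ g
injective⇒strictlySurjective {k = zero} _ _ ()
injective⇒strictlySurjective {k = suc _} {g = g} k≤n g-inj i with any? (λ j → g j ≟ i)
... | yes hit  = hit
... | no  miss = contradiction (≤-trans k≤n (injective⇒≤ punchOut∘g-injective)) 1+n≰n
  where
  i≢g : ∀ j → i ≢ g j
  i≢g j i≡gj = miss (j , sym i≡gj)

  punchOut∘g-injective : Injective _≡_ _≡_ (λ j → punchOut (i≢g j))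
  punchOut∘g-injective eq = g-inj (punchOut-injective (i≢g _) (i≢g _) eq)

Nbhd⊆ClosedNbhd : (G : Graph) → V G → V G → Set
Nbhd⊆ClosedNbhd G u v = ∀ {w} → Adj G u w → w ≡ v ⊎ Adj G v w

module _ (G : Graph) {k : ℕ} (c : V G → Fin k) where

  Dominates : V G → V G → Set
  Dominates u v = ∀ {y d} → Walk G u y d →
                  ∃[ y′ ] ∃[ d′ ] (c y′ ≡ c y × Walk G v y′ d′ × d′ ≤ d)

  ClosedNbhdHasAllColours : V G → Set
  ClosedNbhdHasAllColours v = ∀ i → ∃[ y ] (c y ≡ i × (y ≡ v ⊎ Adj G v y))

  dominates-setDist : ∀ {u v i d} → Dominates u v → Dominates v u →
                      SetDist G k c u i d → SetDist G k c v i d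
  dominates-setDist {v = v} {i} {d} u≼v v≼u ((y , cy≡i , u⇝y) , u-minimal)
    with y′ , d′ , cy′≡cy , v⇝y′ , d′≤d ← u≼v u⇝y
    = (y′ , cy′≡i , subst (Walk G v y′) d′≡d v⇝y′) , v-minimal
    where
    v-minimal : ∀ x j → c x ≡ i → Walk G v x j → d ≤ j
    v-minimal x j cx≡i v⇝x with z , j′ , cz≡cx , u⇝z , j′≤j ← v≼u v⇝x
      = ≤-trans (u-minimal z j′ (trans cz≡cx cx≡i) u⇝z) j′≤j

    cy′≡i : c y′ ≡ i
    cy′≡i = trans cy′≡cy cy≡i

    d′≡d : d′ ≡ d
    d′≡d = ≤-antisym d′≤d (v-minimal y′ d′ cy′≡i v⇝y′)

  dominates⇒sameCode : ∀ {u v} → Dominates u v → Dominates v u → SameCode G k c u v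
  dominates⇒sameCode u≼v v≼u _ _ = dominates-setDist u≼v v≼u , dominates-setDist v≼u u≼v

  twin-dominates : ∀ {u v} → c u ≡ c v → Nbhd⊆ClosedNbhd G u v → Dominates u v
  twin-dominates cu≡cv _ nil = _ , zero , sym cu≡cv , nil , z≤n
  twin-dominates _ N⊆N[v] (cons {k = d} u~w w⇝y) with N⊆N[v] u~w
  ... | inj₁ refl = _ , d , refl , w⇝y , n≤1+n d
  ... | inj₂ v~w  = _ , suc d , refl , cons v~w w⇝y , ≤-refl

  allColoursNear-dominates : ∀ {u v} → c u ≡ c v → ClosedNbhdHasAllColours v → Dominates u v
  allColoursNear-dominates cu≡cv _ nil = _ , zero , sym cu≡cv , nil , z≤n
  allColoursNear-dominates _ near (cons {v = y} _ _) with near (c y)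
  ... | y′ , cy′≡cy , inj₁ refl = y′ , zero , cy′≡cy , nil , z≤n
  ... | y′ , cy′≡cy , inj₂ v~y′ = y′ , 1 , cy′≡cy , cons v~y′ nil , s≤s z≤n

Connected⇒Edge : ∀ {m} (G : SimpleGraph m) → 2 ≤ m → Connected (toGraph G) → Edge G
Connected⇒Edge G (s≤s (s≤s z≤n)) connected with connected fzero (fsuc fzero)
... | _ , cons {w = fzero}  0~0 _ = contradiction (trans (sym 0~0) (irrefl G fzero)) λ ()
... | _ , cons {w = fsuc w} 0~w _ = (fzero , fsuc w) , s≤s z≤n , 0~w

module _ {m n : ℕ} (G : SimpleGraph m) (e : Edge G) where

  private
    Corona = EdgeCorona G (Complete n)

  copy : Fin n → V Corona
  copy j = inj₂ (e , j)

  end : V Corona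
  end = inj₁ (proj₁ (proj₁ e))

  copy-injective : Injective _≡_ _≡_ copy
  copy-injective refl = refl

  copy-twins : ∀ j l → Nbhd⊆ClosedNbhd Corona (copy j) (copy l)
  copy-twins j l {inj₁ b}       b∈e         = inj₂ b∈e
  copy-twins j l {inj₂ (_ , q)} (refl , _) with q ≟ l
  ... | yes refl = inj₁ refl
  ... | no  q≢l  = inj₂ (refl , q≢l ∘ sym)

  module _ {k : ℕ} (c : V Corona → Fin k) (locating : IsLocatingRainbowColoring Corona k c) where

    private
      distinguishes : ∀ {u v} → u ≢ v → Dominates Corona c u v → Dominates Corona c v u → ⊥
      distinguishes u≢v u≼v v≼u = proj₂ (proj₂ locating) _ _ u≢v (dominates⇒sameCode Corona c u≼v v≼u)

    copyColouring-injective : Injective _≡_ _≡_ (c ∘ copy)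
    copyColouring-injective {j} {l} cj≡cl with j ≟ l
    ... | yes j≡l = j≡l
    ... | no  j≢l = ⊥-elim (distinguishes (j≢l ∘ copy-injective)
                      (twin-dominates Corona c cj≡cl (copy-twins j l))
                      (twin-dominates Corona c (sym cj≡cl) (copy-twins l j)))

    copyColouring-notSurjective : ¬ StrictlySurjective _≡_ (c ∘ copy)
    copyColouring-notSurjective onto with j , cj≡cend ← onto (c end)
      = distinguishes (λ ())
          (allColoursNear-dominates Corona c (sym cj≡cend) copy-allColours)
          (allColoursNear-dominates Corona c cj≡cend end-allColours)
      where
      end-allColours : ClosedNbhdHasAllColours Corona c end
      end-allColours i with l , cl≡i ← onto i = copy l , cl≡i , inj₂ (inj₁ refl)

      copy-allColours : ClosedNbhdHasAllColours Corona c (copy j)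
      copy-allColours i with l , cl≡i ← onto i | l ≟ j
      ... | yes refl = copy l , cl≡i , inj₁ refl
      ... | no  l≢j  = copy l , cl≡i , inj₂ (refl , l≢j ∘ sym)

mainTheorem3 : (m n : ℕ) → 2 ≤ m → 2 ≤ n →
    (G : SimpleGraph m) → Connected (toGraph G) →
    (k : ℕ) (c : V (EdgeCorona G (Complete n)) → Fin k) →
    IsLocatingRainbowColoring (EdgeCorona G (Complete n)) k c →
    suc n ≤ k
mainTheorem3 _ _ 2≤m _ G connected _ c locating = ≰⇒> λ k≤n →
  copyColouring-notSurjective G e c locating
    (injective⇒strictlySurjective k≤n (copyColouring-injective G e c locating))
  where
  e : Edge G
  e = Connected⇒Edge G 2≤m connected
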